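{- Let $S_{FF}\subseteq S$ be the set of sorts having only finitely many finite trees, and for each sort $s$ let $F_s^{\mathrm{infin}} := \{(g: s_1\times\cdots\times s_n\to s)\in F_s\mid \exists i\in\{1,\dots,n\}: s_i\in S_{0F}\}$, where $S_{0F}$ is the set of sorts having no finite trees. Then $S_{FF}$ is the least fixed point of $f:\mathcal P(S)\to\mathcal P(S)$, $f(X) := X\cup S_{0F}\cup\{ s\in S\mid |F_s\setminus F_s^{\mathrm{infin}}|<\infty \wedge \forall (g: s_1\times\cdots\times s_n\to s)\in F_s\setminus F_s^{\mathrm{infin}}\ \forall i\in\{1,\dots,n\}: s_i\in X\}$.
   Context: Signature: a set of sorts $S$ and generators, each with an arity $g: s_1\times\cdots\times s_n\to s$ ($n\ge0$); $F_s$ is the (nonempty, possibly infinite) set of generators of sort $s$; every sort is assumed to have at least two generators. A tree of sort $s$ is a (possibly infinite) rooted ordered tree whose root is labeled by some $g: s_1\times\cdots\times s_n\to s$ in $F_s$ and whose $n$ children, in order, are roots of trees of sorts $s_1,\dots,s_n$; it is finite if it has finitely many nodes. $\mathcal P(S)$ is the power set of $S$. -}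

module Defs where

open import Level using (0ℓ)
open import Data.List using (List; []; _∷_)
open import Data.List.Relation.Unary.All using (All)
open import Data.List.Relation.Unary.Any using (Any)
open import Data.List.Membership.Propositional using (_∈_)
open import Data.Product using (Σ; _×_; ∃)
open import Data.Sum using (_⊎_)
open import Relation.Nullary using (¬_)
open import Relation.Binary.PropositionalEquality using (_≡_)

record Signature : Set₁ where
  field
    Sort  : Set
    Gen   : Sort → Set
    arity : {s : Sort} → Gen s → List Sort

open Signature public

AtLeastTwoGenerators : Signature → Set
AtLeastTwoGenerators Sg = ∀ s → Σ (Gen Sg s) λ g → Σ (Gen Sg s) λ h → ¬ (g ≡ h)

Subset : Set → Set₁
Subset A = A → Set

_⊆_ : {A : Set} → Subset A → Subset A → Set
X ⊆ Y = ∀ a → X a → Y a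

FiniteSubset : {A : Set} → Subset A → Set
FiniteSubset {A} P = Σ (List A) λ xs → All P xs × (∀ x → P x → x ∈ xs)

FiniteType : Set → Set
FiniteType A = FiniteSubset {A} (λ _ → A)

module _ (Sg : Signature) where

  -- Finite trees of a given sort (inductive, hence finitely many nodes),
  -- together with finite ordered lists of subtrees of prescribed sorts.
  data Tree : Sort Sg → Set
  data Trees : List (Sort Sg) → Set

  data Tree where
    node : {s : Sort Sg} (g : Gen Sg s) → Trees (arity Sg g) → Tree s

  data Trees where
    []  : Trees []
    _∷_ : {s : Sort Sg} {ss : List (Sort Sg)} → Tree s → Trees ss → Trees (s ∷ ss)

  S0F : Subset (Sort Sg)
  S0F s = ¬ Tree s

  SFF : Subset (Sort Sg)
  SFF s = FiniteType (Tree s)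

  Infin : {s : Sort Sg} → Gen Sg s → Set
  Infin g = Any S0F (arity Sg g)

  NotInfin : (s : Sort Sg) → Subset (Gen Sg s)
  NotInfin s g = ¬ Infin g

  f : Subset (Sort Sg) → Subset (Sort Sg)
  f X s = X s ⊎ (S0F s ⊎
            (FiniteSubset (NotInfin s)
             × (∀ (g : Gen Sg s) → NotInfin s g → All X (arity Sg g))))

IsLeastFixedPoint : {A : Set} → (Subset A → Subset A) → Subset A → Set₁
IsLeastFixedPoint F P =
  ((F P ⊆ P) × (P ⊆ F P)) ×
  (∀ (X : Subset _) → F X ⊆ X → X ⊆ F X → P ⊆ X)

module Submission where

-- Call a generator admissible if it lies outside F_s^infin. Closure: a sort in
-- f(S_FF) either has no finite trees or has finitely many admissible generators,
-- each with finitely many tuples of argument trees.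
-- Minimality: let X be a pre-fixed point and s ∈ S_FF, so the finite trees of s
-- have bounded depth. Fixing trees for the other arguments of an admissible
-- generator g, every tree of an argument sort s' of g embeds injectively into the
-- trees of s, one level deeper; hence s' ∈ S_FF with a smaller depth bound, and by
-- induction on that bound all argument sorts of admissible generators lie in X.
-- The roots of the finitely many trees of s enumerate its admissible generators,
-- so s ∈ f(X) ⊆ X.

open import Defs
open import Level using (0ℓ)
open import Axiom.ExcludedMiddle using (ExcludedMiddle)
open import Data.Empty using (⊥-elim)
open import Data.List using (List; []; _∷_; _++_; map; concatMap; cartesianProduct)
open import Data.List.Extrema.Nat using (max; xs≤max)
open import Data.List.Membership.Propositional using (_∈_)
open import Data.List.Membership.Propositional.Properties
  using (∈-map⁺; ∈-++⁺ˡ; ∈-++⁺ʳ; ∈-concatMap⁺; ∈-cartesianProduct⁺)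
open import Data.List.Relation.Unary.All as All using (All; []; _∷_)
import Data.List.Relation.Unary.All.Properties as All
open import Data.List.Relation.Unary.Any as Any using (Any; here; there)
open import Data.Nat using (ℕ; zero; suc; _⊔_; _≤_; _<_; s≤s; s≤s⁻¹)
open import Data.Nat.Properties using (m≤m⊔n; m≤n⇒m≤o⊔n; <-≤-trans; n≮0)
open import Data.Product using (Σ; ∃; _×_; _,_; uncurry)
open import Data.Sum using (inj₁; inj₂)
open import Function using (_∘_)
open import Function.Definitions using (Injective)
open import Relation.Nullary using (¬_; yes; no)
open import Relation.Nullary.Decidable using (decidable-stable)
open import Relation.Binary.PropositionalEquality using (_≡_; refl; sym; cong)
open Relation.Binary.PropositionalEquality.≡-Reasoning

finiteType : {A : Set} (xs : List A) → (∀ x → x ∈ xs) → FiniteType A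
finiteType xs complete = xs , All.tabulate (λ {x} _ → x) , λ x _ → complete x

finite-image : {A B : Set} {P : Subset B} (h : A → B) → FiniteType A →
               (∀ a → P (h a)) → (∀ b → P b → ∃ λ a → h a ≡ b) → FiniteSubset P
finite-image {P = P} h (as , _ , complete) image⊆P P⊆image =
  map h as , All.map⁺ (All.tabulate (λ {a} _ → image⊆P a)) , hit
  where
    hit : ∀ b → P b → b ∈ map h as
    hit b pb with P⊆image b pb
    ... | a , refl = ∈-map⁺ h (complete a a)

finite-surjection : {A B : Set} (h : A → B) → (∀ b → ∃ λ a → h a ≡ b) →
                    FiniteType A → FiniteType B
finite-surjection h onto finA = finite-image h finA h (λ b _ → onto b)

finite-× : {A B : Set} → FiniteType A → FiniteType B → FiniteType (A × B)
finite-× (as , _ , completeA) (bs , _ , completeB) =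
  finiteType (cartesianProduct as bs)
             (λ (a , b) → ∈-cartesianProduct⁺ (completeA a a) (completeB b b))

finite-Σ : {I : Set} {B : I → Set} {P : Subset I} → FiniteSubset P →
           (∀ i → P i → FiniteType (B i)) → (∀ i → B i → P i) → FiniteType (Σ I B)
finite-Σ {I} {B} (is , Pis , completeI) fibre-finite B⊆P =
  finiteType (pairs fibres) (λ (i , b) → pairs-complete fibres b (completeI i (B⊆P i b)))
  where
    fibres : All (FiniteType ∘ B) is
    fibres = All.map (λ {i} → fibre-finite i) Pis

    pairs : ∀ {js} → All (FiniteType ∘ B) js → List (Σ I B)
    pairs [] = []
    pairs {j ∷ _} ((bs , _) ∷ fs) = map (j ,_) bs ++ pairs fs

    pairs-complete : ∀ {js} (fs : All (FiniteType ∘ B) js) {i} (b : B i) →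
                     i ∈ js → (i , b) ∈ pairs fs
    pairs-complete ((_ , _ , complete) ∷ _) b (here refl) = ∈-++⁺ˡ (∈-map⁺ (_ ,_) (complete b b))
    pairs-complete {j ∷ _} ((bs , _) ∷ fs) b (there i∈js) =
      ∈-++⁺ʳ (map (j ,_) bs) (pairs-complete fs b i∈js)

finite-injection : ExcludedMiddle 0ℓ → {A B : Set} (e : A → B) → Injective _≡_ _≡_ e →
                   FiniteType B → FiniteType A
finite-injection lem {A} {B} e e-injective (bs , _ , complete) =
  finiteType (concatMap preimage bs)
             (λ a → ∈-concatMap⁺ preimage (Any.map (λ { refl → preimage-complete a }) (complete (e a) (e a))))
  where
    preimage : B → List A
    preimage b with lem {∃ λ a → e a ≡ b}
    ... | yes (a , _) = a ∷ []
    ... | no _        = []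

    preimage-complete : ∀ a → a ∈ preimage (e a)
    preimage-complete a with lem {∃ λ a′ → e a′ ≡ e a}
    ... | yes (_ , ea′≡ea) = here (e-injective (sym ea′≡ea))
    ... | no none          = ⊥-elim (none (a , refl))

finite⇒bounded : {A : Set} → FiniteType A → (h : A → ℕ) → ∃ λ n → ∀ a → h a < n
finite⇒bounded (as , _ , complete) h =
  suc (max 0 (map h as)) , λ a → s≤s (All.lookup (xs≤max 0 (map h as)) (∈-map⁺ h (complete a a)))

module _ (Sg : Signature) where

  private
    T  = Tree Sg
    Ts = Trees Sg

  depth  : ∀ {s} → T s → ℕ
  depths : ∀ {ss} → Ts ss → ℕ
  depth (node _ ts) = suc (depths ts)
  depths []         = 0
  depths (t ∷ ts)   = depth t ⊔ depths ts

  root : ∀ {s} → T s → Gen Sg s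
  root (node g _) = g

  node-injective : ∀ {s} {g : Gen Sg s} {us ts : Ts (arity Sg g)} →
                   _≡_ {A = T s} (node g us) (node g ts) → us ≡ ts
  node-injective refl = refl

  Trees⇒¬Any-S0F : ∀ {ss} → Ts ss → ¬ Any (S0F Sg) ss
  Trees⇒¬Any-S0F (t ∷ _)  (here noTree) = noTree t
  Trees⇒¬Any-S0F (_ ∷ ts) (there s∈S0F) = Trees⇒¬Any-S0F ts s∈S0F

  ¬Any-S0F⇒Trees : ExcludedMiddle 0ℓ → ∀ {ss} → ¬ Any (S0F Sg) ss → Ts ss
  ¬Any-S0F⇒Trees lem {[]}    _    = []
  ¬Any-S0F⇒Trees lem {_ ∷ _} none =
    decidable-stable lem (none ∘ here) ∷ ¬Any-S0F⇒Trees lem (none ∘ there)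

  Trees-finite : ∀ {ss} → All (SFF Sg) ss → FiniteType (Ts ss)
  Trees-finite []           = finiteType ([] ∷ []) λ { [] → here refl }
  Trees-finite (fin ∷ fins) =
    finite-surjection (uncurry _∷_) (λ { (t ∷ ts) → (t , ts) , refl })
                      (finite-× fin (Trees-finite fins))

  SFF-from-generators : ∀ {s} → FiniteSubset (NotInfin Sg s) →
                        (∀ g → NotInfin Sg s g → All (SFF Sg) (arity Sg g)) → SFF Sg s
  SFF-from-generators gens arguments-finite =
    finite-surjection (uncurry node) (λ { (node g ts) → (g , ts) , refl })
      (finite-Σ gens (λ g → Trees-finite ∘ arguments-finite g) (λ _ → Trees⇒¬Any-S0F))

  f-SFF⊆SFF : f Sg (SFF Sg) ⊆ SFF Sg
  f-SFF⊆SFF _ (inj₁ fin)                 = fin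
  f-SFF⊆SFF _ (inj₂ (inj₁ noTree))       = finiteType [] (⊥-elim ∘ noTree)
  f-SFF⊆SFF _ (inj₂ (inj₂ (gens , args))) = SFF-from-generators gens args

  NotInfin-finite : ExcludedMiddle 0ℓ → ∀ {s} → SFF Sg s → FiniteSubset (NotInfin Sg s)
  NotInfin-finite lem fin =
    finite-image root fin (λ { (node _ ts) → Trees⇒¬Any-S0F ts })
                 (λ g ni → node g (¬Any-S0F⇒Trees lem ni) , refl)

  lookup : ∀ {ss s} → s ∈ ss → Ts ss → T s
  lookup (here refl) (u ∷ _)  = u
  lookup (there p)   (_ ∷ us) = lookup p us

  update : ∀ {ss s} → s ∈ ss → T s → Ts ss → Ts ss
  update (here refl) t (_ ∷ us) = t ∷ us
  update (there p)   t (u ∷ us) = u ∷ update p t us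

  lookup-update : ∀ {ss s} (p : s ∈ ss) (t : T s) (us : Ts ss) → lookup p (update p t us) ≡ t
  lookup-update (here refl) t (_ ∷ _)  = refl
  lookup-update (there p)   t (_ ∷ us) = lookup-update p t us

  depth≤depths-update : ∀ {ss s} (p : s ∈ ss) (t : T s) (us : Ts ss) →
                        depth t ≤ depths (update p t us)
  depth≤depths-update (here refl) t (_ ∷ us) = m≤m⊔n (depth t) (depths us)
  depth≤depths-update (there p)   t (u ∷ us) = m≤n⇒m≤o⊔n (depth u) (depth≤depths-update p t us)

  embed : ∀ {s s′} (g : Gen Sg s) → s′ ∈ arity Sg g → Ts (arity Sg g) → T s′ → T s
  embed g p us t = node g (update p t us)

  embed-injective : ∀ {s s′} (g : Gen Sg s) (p : s′ ∈ arity Sg g) (us : Ts (arity Sg g)) →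
                    Injective _≡_ _≡_ (embed g p us)
  embed-injective g p us {t} {t′} eq = begin
    t                         ≡⟨ sym (lookup-update p t us) ⟩
    lookup p (update p t us)  ≡⟨ cong (lookup p) (node-injective eq) ⟩
    lookup p (update p t′ us) ≡⟨ lookup-update p t′ us ⟩
    t′                        ∎

  depth<depth-embed : ∀ {s s′} (g : Gen Sg s) (p : s′ ∈ arity Sg g) (us : Ts (arity Sg g))
                      (t : T s′) → depth t < depth (embed g p us t)
  depth<depth-embed g p us t = s≤s (depth≤depths-update p t us)

  argument-SFF : ExcludedMiddle 0ℓ → ∀ {s s′} {g : Gen Sg s} → NotInfin Sg s g →
                 s′ ∈ arity Sg g → SFF Sg s → SFF Sg s′
  argument-SFF lem {g = g} ni p =
    finite-injection lem (embed g p us) (embed-injective g p us)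
    where us = ¬Any-S0F⇒Trees lem ni

  DepthBelow : ℕ → Sort Sg → Set
  DepthBelow n s = ∀ (t : T s) → depth t < n

  SFF∩DepthBelow⊆prefixed : ExcludedMiddle 0ℓ → (X : Subset (Sort Sg)) → f Sg X ⊆ X →
                            ∀ n s → SFF Sg s → DepthBelow n s → X s
  SFF∩DepthBelow⊆prefixed lem X fX⊆X zero s _ below =
    fX⊆X s (inj₂ (inj₁ λ t → n≮0 (below t)))
  SFF∩DepthBelow⊆prefixed lem X fX⊆X (suc n) s fin below =
    fX⊆X s (inj₂ (inj₂ (NotInfin-finite lem fin , arguments∈X)))
    where
      arguments∈X : ∀ g → NotInfin Sg s g → All X (arity Sg g)
      arguments∈X g ni = All.tabulate λ p →
        SFF∩DepthBelow⊆prefixed lem X fX⊆X n _ (argument-SFF lem ni p fin) λ t →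
          <-≤-trans (depth<depth-embed g p us t) (s≤s⁻¹ (below (embed g p us t)))
        where us = ¬Any-S0F⇒Trees lem ni

  SFF⊆prefixed : ExcludedMiddle 0ℓ → (X : Subset (Sort Sg)) → f Sg X ⊆ X → SFF Sg ⊆ X
  SFF⊆prefixed lem X fX⊆X s fin =
    let n , below = finite⇒bounded fin depth in SFF∩DepthBelow⊆prefixed lem X fX⊆X n s fin below

lemma3 : ExcludedMiddle 0ℓ → (Sg : Signature) → AtLeastTwoGenerators Sg →
    IsLeastFixedPoint (f Sg) (SFF Sg)
lemma3 lem Sg _ = (f-SFF⊆SFF Sg , λ _ → inj₁) , λ X fX⊆X _ → SFF⊆prefixed Sg lem X fX⊆X
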